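{- For all integers $n\ge 0$ and $r\ge 0$, \[ B_{n,r}^{L}(x)=e^{ -x}\sum_{k=0}^{\infty}\frac{\langle k+2r\rangle_{n}}{k!}x^{k}. \]
   Context: For a nonnegative integer $r$ and integers $0\le k\le n$, the $r$-Lah number $L_r(n,k)$ is the number of partitions of a set with $n+r$ elements into $k+r$ non-empty linearly ordered subsets such that $r$ distinguished elements lie in distinct subsets; equivalently $L_r(n,k)=\frac{n!}{k!}\binom{n+2r-1}{k+2r-1}$, with exponential generating function $\sum_{n\ge k}L_r(n,k)\frac{t^n}{n!}=\frac{1}{k!}\left(\frac{1}{1-t}-1\right)^k\left(\frac{1}{1-t}\right)^{2r}$. The $r$-extended Lah-Bell polynomials are $B^L_{n,r}(x)=\sum_{k=0}^n L_r(n,k)x^k$. The rising factorial is $\langle x\rangle_0=1$, $\langle x\rangle_n=x(x+1)\cdots(x+n-1)$ for $n\ge1$. -}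

module Defs where

open import Data.Nat as N using (ℕ; zero; suc; _∸_; _≤?_; _!)
open import Data.Nat.Combinatorics using (_C_)
open import Data.Nat.Properties using (_!≢0)
open import Data.Integer using (+_)
open import Data.Rational using (ℚ; _/_; _+_; _*_; -_; 0ℚ; 1ℚ)
open import Relation.Nullary using (yes; no)


rising : ℕ → ℕ → ℕ
rising x zero    = 1
rising x (suc n) = rising x n N.* (x N.+ n)

_over_! : ℕ → ℕ → ℚ
a over m ! = _/_ (+ a) (m !) {{m !≢0}}

-- r-Lah number L_r(n,k) = n!/k! * binom(n+2r-1, k+2r-1)
-- (with the standard convention binom(-1,-1) = 1, binom(m,-1) = 0 for m ≥ 0,
--  which only matters for r = 0, k = 0)
lahR : ℕ → ℕ → ℕ → ℚ
lahR r n k with k N.+ 2 N.* r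
... | zero  with n
...   | zero  = 1ℚ
...   | suc _ = 0ℚ
lahR r n k | suc j = ((n !) N.* ((n N.+ 2 N.* r ∸ 1) C j)) over k !

-- formal power series over ℚ: coefficient sequences
Series : Set
Series = ℕ → ℚ

sumTo : ℕ → (ℕ → ℚ) → ℚ
sumTo zero    f = f zero
sumTo (suc m) f = sumTo m f + f (suc m)

_⊛_ : Series → Series → Series
(f ⊛ g) m = sumTo m (λ i → f i * g (m ∸ i))

-- r-extended Lah-Bell polynomial B^L_{n,r}(x) = Σ_{k=0}^n L_r(n,k) x^k,
-- as its coefficient sequence
lahBell : ℕ → ℕ → Series
lahBell n r k with k ≤? n
... | yes _ = lahR r n k
... | no  _ = 0ℚ

-- e^{-x} = Σ_k (-1)^k x^k / k!
expNeg : Series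
expNeg zero    = 1ℚ
expNeg (suc k) = - (1 over (suc k) !) * sign k
  where
  sign : ℕ → ℚ
  sign zero    = 1ℚ
  sign (suc j) = - sign j

risingSeries : ℕ → ℕ → Series
risingSeries n r k = rising (k N.+ 2 N.* r) n over k !

module Submission where

-- Write R_{a,n} = Σ_k ⟨k+a⟩_n x^k / k! and θ = x d/dx (on coefficients,
-- θ f k = k · f k).  Since ⟨k+a⟩_{n+1} = ⟨k+a⟩_n (a+n) + k ⟨k+a⟩_n we get
--   R_{a,n+1} = (a+n) R_{a,n} + θ R_{a,n},   and  θ R_{a,n} = x R_{a+1,n},
-- while R_{a,0} = e^x.  The Leibniz rule for θ on Cauchy products, together
-- with θ e^{±x} = ±x e^{±x}, gives e^{-x} e^x = 1.  Hence the numbers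
-- lah a n m = m! [x^m] e^{-x} R_{a,n} obey
--   lah a (n+1) (m+1) = (a+n) lah a n (m+1) + (m+1) lah (a+1) n m,
-- with lah a 0 m = [m = 0].  Solving this recurrence over ℕ with binomial
-- coefficients gives lah a n m = n! C(n+a-1, m+a-1), which for a = 2r is
-- m! L_r(n,m), and lah a n m = 0 for m > n.

open import Defs
open import Data.Nat using (ℕ)
open import Relation.Binary.PropositionalEquality using (_≡_)

module LahNumbers where

  open import Data.Nat
  open import Data.Nat.Properties
    using (+-suc; suc-injective; +-cancelʳ-≡; m≤n⇒m≤1+n; m≤n+m; *-zeroʳ; *-identityʳ; +-identityʳ)
  open import Data.Nat.Combinatorics
    using (_C_; nCn≡1; nC1≡n; k>n⇒nCk≡0; nCk+nC[k+1]≡[n+1]C[k+1])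
  open import Data.Nat.Tactic.RingSolver using (solve-∀)
  open import Relation.Binary.PropositionalEquality
  open ≡-Reasoning

  pascal : ∀ n k → suc n C suc k ≡ n C k + n C suc k
  pascal n k = sym (nCk+nC[k+1]≡[n+1]C[k+1] n k)

  absorption : ∀ n k → suc k * (suc n C suc k) ≡ suc n * (n C k)
  absorption n zero = trans (+-identityʳ _) (trans (nC1≡n (suc n)) (sym (*-identityʳ (suc n))))
  absorption zero (suc k) = *-zeroʳ (suc (suc k))
  absorption (suc n) (suc k) = begin
    suc (suc k) * (suc (suc n) C suc (suc k))
      ≡⟨ cong (suc (suc k) *_) (pascal (suc n) (suc k)) ⟩
    suc (suc k) * (suc n C suc k + suc n C suc (suc k))
      ≡⟨ regroup k (suc n C suc k) (suc n C suc (suc k)) ⟩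
    suc k * (suc n C suc k) + suc n C suc k + suc (suc k) * (suc n C suc (suc k))
      ≡⟨ cong₂ (λ u v → u + suc n C suc k + v) (absorption n k) (absorption n (suc k)) ⟩
    suc n * (n C k) + suc n C suc k + suc n * (n C suc k)
      ≡⟨ collect n (n C k) (n C suc k) (suc n C suc k) ⟩
    suc n * (n C k + n C suc k) + suc n C suc k
      ≡⟨ cong (λ u → suc n * u + suc n C suc k) (sym (pascal n k)) ⟩
    suc n * (suc n C suc k) + suc n C suc k
      ≡⟨ absorb-one n (suc n C suc k) ⟩
    suc (suc n) * (suc n C suc k) ∎
    where
    regroup : ∀ k x y → suc (suc k) * (x + y) ≡ suc k * x + x + suc (suc k) * y
    regroup = solve-∀
    collect : ∀ n x y z → suc n * x + z + suc n * y ≡ suc n * (x + y) + z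
    collect = solve-∀
    absorb-one : ∀ n z → suc n * z + z ≡ suc (suc n) * z
    absorb-one = solve-∀

  pascal-weighted : ∀ n k → suc n * (n C k) + k * (suc n C k) ≡ suc n * (suc n C k)
  pascal-weighted n zero = +-identityʳ (suc n * 1)
  pascal-weighted n (suc k) = begin
    suc n * (n C suc k) + suc k * (suc n C suc k) ≡⟨ cong (suc n * (n C suc k) +_) (absorption n k) ⟩
    suc n * (n C suc k) + suc n * (n C k)         ≡⟨ factor n (n C suc k) (n C k) ⟩
    suc n * (n C k + n C suc k)                   ≡⟨ cong (suc n *_) (sym (pascal n k)) ⟩
    suc n * (suc n C suc k)                       ∎
    where
    factor : ∀ n x y → suc n * x + suc n * y ≡ suc n * (y + x)
    factor = solve-∀

  -- The numbers lah a n m = m! [x^m] e^{-x} Σ_k ⟨k+a⟩_n x^k / k!, given by the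
  -- recurrence that these coefficients satisfy (see coeff-expNeg-rising below).
  -- For a = 2r and m ≤ n they are m! L_r(n,m).
  lah : ℕ → ℕ → ℕ → ℕ
  lah a zero    zero    = 1
  lah a zero    (suc m) = 0
  lah a (suc n) zero    = (a + n) * lah a n zero
  lah a (suc n) (suc m) = (a + n) * lah a n (suc m) + suc m * lah (suc a) n m

  lah-vanish : ∀ a n m → n < m → lah a n m ≡ 0
  lah-vanish a zero    (suc m) _         = refl
  lah-vanish a (suc n) (suc m) (s≤s n<m) = begin
    (a + n) * lah a n (suc m) + suc m * lah (suc a) n m
      ≡⟨ cong₂ (λ u v → (a + n) * u + suc m * v) (lah-vanish a n (suc m) (m≤n⇒m≤1+n n<m)) (lah-vanish (suc a) n m n<m) ⟩
    (a + n) * 0 + suc m * 0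
      ≡⟨ cong₂ _+_ (*-zeroʳ (a + n)) (*-zeroʳ (suc m)) ⟩
    0 ∎

  lah-zero-column : ∀ n → lah 0 (suc n) 0 ≡ 0
  lah-zero-column zero    = refl
  lah-zero-column (suc n) = trans (cong (suc n *_) (lah-zero-column n)) (*-zeroʳ (suc n))

  -- The recurrence step behind the closed form for a = b + 1, obtained from the
  -- weighted Pascal rule by cancelling b C(n+b+1,m+b).
  lah-step : ∀ b n m →
    (suc b + n) * (n ! * ((n + b) C (m + b))) + m * (n ! * ((suc n + b) C (m + b)))
      ≡ suc n ! * ((suc n + b) C (m + b))
  lah-step b n m = begin
    (suc b + n) * (n ! * X) + m * (n ! * Y) ≡⟨ factor b n m (n !) X Y ⟩
    n ! * ((suc b + n) * X + m * Y)         ≡⟨ cong (n ! *_) core ⟩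
    n ! * (suc n * Y)                       ≡⟨ unfold-! n (n !) Y ⟩
    suc n ! * Y                             ∎
    where
    X = (n + b) C (m + b)
    Y = (suc n + b) C (m + b)
    factor : ∀ b n m f x y → (suc b + n) * (f * x) + m * (f * y) ≡ f * ((suc b + n) * x + m * y)
    factor = solve-∀
    unfold-! : ∀ n f y → f * (suc n * y) ≡ (f + n * f) * y
    unfold-! = solve-∀
    regroupˡ : ∀ b n m x y → (suc b + n) * x + m * y + b * y ≡ suc (n + b) * x + (m + b) * y
    regroupˡ = solve-∀
    regroupʳ : ∀ b n y → suc (n + b) * y ≡ suc n * y + b * y
    regroupʳ = solve-∀
    core : (suc b + n) * X + m * Y ≡ suc n * Y
    core = +-cancelʳ-≡ (b * Y) _ _ (begin
      (suc b + n) * X + m * Y + b * Y ≡⟨ regroupˡ b n m X Y ⟩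
      suc (n + b) * X + (m + b) * Y   ≡⟨ pascal-weighted (n + b) (m + b) ⟩
      suc (n + b) * Y                 ≡⟨ regroupʳ b n Y ⟩
      suc n * Y + b * Y               ∎)

  lah-pos : ∀ b n m → lah (suc b) n m ≡ n ! * ((n + b) C (m + b))
  lah-pos b zero    zero    = sym (trans (+-identityʳ (b C b)) (nCn≡1 b))
  lah-pos b zero    (suc m) = sym (trans (+-identityʳ _) (k>n⇒nCk≡0 (s≤s (m≤n+m b m))))
  lah-pos b (suc n) zero    = begin
    (suc b + n) * lah (suc b) n 0           ≡⟨ cong ((suc b + n) *_) (lah-pos b n 0) ⟩
    (suc b + n) * (n ! * ((n + b) C b))     ≡⟨ sym (+-identityʳ _) ⟩
    (suc b + n) * (n ! * ((n + b) C b)) + 0 ≡⟨ lah-step b n 0 ⟩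
    suc n ! * ((suc n + b) C b)             ∎
  lah-pos b (suc n) (suc m) = begin
    (suc b + n) * lah (suc b) n (suc m) + suc m * lah (suc (suc b)) n m
      ≡⟨ cong₂ (λ u v → (suc b + n) * u + suc m * v) (lah-pos b n (suc m)) (lah-pos (suc b) n m) ⟩
    (suc b + n) * (n ! * ((n + b) C (suc m + b))) + suc m * (n ! * ((n + suc b) C (m + suc b)))
      ≡⟨ cong₂ (λ u v → (suc b + n) * (n ! * ((n + b) C (suc m + b))) + suc m * (n ! * (u C v))) (+-suc n b) (+-suc m b) ⟩
    (suc b + n) * (n ! * ((n + b) C (suc m + b))) + suc m * (n ! * ((suc n + b) C (suc m + b)))
      ≡⟨ lah-step b n (suc m) ⟩
    suc n ! * ((suc n + b) C (suc m + b)) ∎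

  lah-zero : ∀ n m → lah 0 (suc n) (suc m) ≡ suc n ! * (n C m)
  lah-zero zero    zero    = refl
  lah-zero zero    (suc m) = *-zeroʳ (suc (suc m))
  lah-zero (suc n) m = begin
    suc n * lah 0 (suc n) (suc m) + suc m * lah 1 (suc n) m
      ≡⟨ cong₂ (λ u v → suc n * u + suc m * v) (lah-zero n m) (lah-pos 0 (suc n) m) ⟩
    suc n * (f * (n C m)) + suc m * (f * ((suc n + 0) C (m + 0)))
      ≡⟨ cong₂ (λ u v → suc n * (f * (n C m)) + suc m * (f * (u C v))) (+-identityʳ (suc n)) (+-identityʳ m) ⟩
    suc n * (f * (n C m)) + suc m * (f * (suc n C m))
      ≡⟨ regroup n m f (n C m) (suc n C m) ⟩
    f * (suc n * (n C m) + m * (suc n C m)) + f * (suc n C m)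
      ≡⟨ cong (λ u → f * u + f * (suc n C m)) (pascal-weighted n m) ⟩
    f * (suc n * (suc n C m)) + f * (suc n C m)
      ≡⟨ unfold-! n f (suc n C m) ⟩
    suc (suc n) ! * (suc n C m) ∎
    where
    f = suc n !
    regroup : ∀ n m f x y → suc n * (f * x) + suc m * (f * y) ≡ f * (suc n * x + m * y) + f * y
    regroup = solve-∀
    unfold-! : ∀ n f y → f * (suc n * y) + f * y ≡ (f + suc n * f) * y
    unfold-! = solve-∀

  lah-binomial : ∀ a n k j → k ≤ n → k + a ≡ suc j → lah a n k ≡ n ! * ((n + a ∸ 1) C j)
  lah-binomial (suc b) n k j _ k+a≡1+j = begin
    lah (suc b) n k              ≡⟨ lah-pos b n k ⟩
    n ! * ((n + b) C (k + b))    ≡⟨ cong₂ (λ u v → n ! * (u C v)) (cong (_∸ 1) (sym (+-suc n b))) k+b≡j ⟩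
    n ! * ((n + suc b ∸ 1) C j)  ∎
    where
    k+b≡j : k + b ≡ j
    k+b≡j = suc-injective (trans (sym (+-suc k b)) k+a≡1+j)
  lah-binomial zero (suc n) (suc m) j _ k+a≡1+j = begin
    lah 0 (suc n) (suc m)        ≡⟨ lah-zero n m ⟩
    suc n ! * (n C m)            ≡⟨ cong₂ (λ u v → suc n ! * (u C v)) (sym (+-identityʳ n)) m≡j ⟩
    suc n ! * ((n + 0) C j)      ∎
    where
    m≡j : m ≡ j
    m≡j = trans (sym (+-identityʳ m)) (suc-injective k+a≡1+j)
  lah-binomial zero _       zero    _ _   ()
  lah-binomial zero zero    (suc m) _ ()  _

open LahNumbers
open import Data.Nat as ℕ using (zero; suc; _!; _∸_; _≤_; z≤n; _≤?_)
open import Data.Nat.Properties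
  using (_!≢0; +-suc; n∸n≡0; +-∸-assoc; m+[n∸m]≡n; m≤n⇒m≤1+n; ≤-refl; ≰⇒>)
open import Data.Integer as ℤ using (+_)
import Data.Integer.Properties as ℤ
open import Data.Rational using (ℚ; _/_; _+_; _*_; -_; 0ℚ; 1ℚ; fromℚᵘ)
open import Data.Rational.Properties
  using ( +-*-commutativeRing; _≟_; toℚᵘ-injective; fromℚᵘ-cong; toℚᵘ-fromℚᵘ
        ; toℚᵘ-homo-*; toℚᵘ-homo-+; 0/n≡0
        ; +-identityˡ; +-identityʳ; +-inverseˡ; +-assoc; neg-distrib-+; neg-distribˡ-*
        ; *-identityˡ; *-zeroˡ; *-zeroʳ; *-assoc; *-distribˡ-+; *-distribʳ-+)
import Data.Rational.Unnormalised as ℚᵘ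
import Data.Rational.Unnormalised.Properties as ℚᵘ
open import Relation.Nullary using (yes; no)
open import Relation.Nullary.Decidable using (dec⇒maybe)
open import Tactic.RingSolver using (solve-∀)
open import Data.Nat.Tactic.RingSolver using () renaming (solve-∀ to ℕ-solve-∀)
open import Tactic.RingSolver.Core.AlmostCommutativeRing
  using (AlmostCommutativeRing; fromCommutativeRing)
open import Level using (0ℓ)
open import Relation.Binary.PropositionalEquality using (refl; sym; trans; cong; cong₂; module ≡-Reasoning)
open ≡-Reasoning

ℚ-ring : AlmostCommutativeRing 0ℓ 0ℓ
ℚ-ring = fromCommutativeRing +-*-commutativeRing (λ x → dec⇒maybe (0ℚ ≟ x))

ι : ℕ → ℚ
ι a = + a / 1

frac-≡ : ∀ a b d e → a ℕ.* suc e ≡ b ℕ.* suc d → + a / suc d ≡ + b / suc e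
frac-≡ a b d e eq = fromℚᵘ-cong {ℚᵘ.mkℚᵘ (+ a) d} {ℚᵘ.mkℚᵘ (+ b) e} (ℚᵘ.*≡* (begin
  + a ℤ.* + suc e  ≡⟨ ℤ.pos-* a (suc e) ⟨
  + (a ℕ.* suc e)  ≡⟨ cong +_ eq ⟩
  + (b ℕ.* suc d)  ≡⟨ ℤ.pos-* b (suc d) ⟩
  + b ℤ.* + suc d  ∎))

fromℚᵘ-+ : ∀ p q → fromℚᵘ p + fromℚᵘ q ≡ fromℚᵘ (p ℚᵘ.+ q)
fromℚᵘ-+ p q = toℚᵘ-injective (ℚᵘ.≃-trans (toℚᵘ-homo-+ (fromℚᵘ p) (fromℚᵘ q))
  (ℚᵘ.≃-trans (ℚᵘ.+-cong (toℚᵘ-fromℚᵘ p) (toℚᵘ-fromℚᵘ q)) (ℚᵘ.≃-sym (toℚᵘ-fromℚᵘ (p ℚᵘ.+ q)))))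

fromℚᵘ-* : ∀ p q → fromℚᵘ p * fromℚᵘ q ≡ fromℚᵘ (p ℚᵘ.* q)
fromℚᵘ-* p q = toℚᵘ-injective (ℚᵘ.≃-trans (toℚᵘ-homo-* (fromℚᵘ p) (fromℚᵘ q))
  (ℚᵘ.≃-trans (ℚᵘ.*-cong (toℚᵘ-fromℚᵘ p) (toℚᵘ-fromℚᵘ q)) (ℚᵘ.≃-sym (toℚᵘ-fromℚᵘ (p ℚᵘ.* q)))))

frac-* : ∀ a b d e → (+ a / suc d) * (+ b / suc e) ≡ + (a ℕ.* b) / (suc d ℕ.* suc e)
frac-* a b d e = trans (fromℚᵘ-* (ℚᵘ.mkℚᵘ (+ a) d) (ℚᵘ.mkℚᵘ (+ b) e))
                       (cong (_/ (suc d ℕ.* suc e)) (sym (ℤ.pos-* a b)))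

ι-* : ∀ a b → ι (a ℕ.* b) ≡ ι a * ι b
ι-* a b = sym (frac-* a b 0 0)

ι-+ : ∀ a b → ι (a ℕ.+ b) ≡ ι a + ι b
ι-+ a b = sym (trans (fromℚᵘ-+ (ℚᵘ.mkℚᵘ (+ a) 0) (ℚᵘ.mkℚᵘ (+ b) 0)) (cong (_/ 1) numerator))
  where
  numerator : + a ℤ.* + 1 ℤ.+ + b ℤ.* + 1 ≡ + (a ℕ.+ b)
  numerator = trans (cong₂ ℤ._+_ (ℤ.*-identityʳ (+ a)) (ℤ.*-identityʳ (+ b))) (sym (ℤ.pos-+ a b))

frac-split : ∀ a n .{{_ : ℕ.NonZero n}} → + a / n ≡ ι a * (+ 1 / n)
frac-split a (suc d) = trans (frac-≡ a (a ℕ.* 1) d (d ℕ.+ 0) (cross a d)) (sym (frac-* a 1 0 d))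
  where
  cross : ∀ a d → a ℕ.* suc (d ℕ.+ 0) ≡ a ℕ.* 1 ℕ.* suc d
  cross = ℕ-solve-∀

cancel-suc : ∀ s n .{{_ : ℕ.NonZero n}} .{{_ : ℕ.NonZero (suc s ℕ.* n)}} →
               ι (suc s) * (+ 1 / (suc s ℕ.* n)) ≡ + 1 / n
cancel-suc s (suc d) = trans (frac-* (suc s) 1 0 (d ℕ.+ s ℕ.* suc d))
                               (frac-≡ (suc s ℕ.* 1) 1 _ d (cross s d))
  where
  cross : ∀ s d → suc s ℕ.* 1 ℕ.* suc d ≡ 1 ℕ.* suc (d ℕ.+ s ℕ.* suc d ℕ.+ 0 ℕ.* suc (d ℕ.+ s ℕ.* suc d))
  cross = ℕ-solve-∀

-- 1/m!, the coefficients of e^x.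
invFact : Series
invFact m = 1 over m !

over-split : ∀ a m → a over m ! ≡ ι a * invFact m
over-split a m = frac-split a (m !) {{m !≢0}}

invFact-suc : ∀ m → ι (suc m) * invFact (suc m) ≡ invFact m
invFact-suc m = cancel-suc m (m !) {{m !≢0}} {{suc m !≢0}}

zero-over : ∀ m → 0 over m ! ≡ 0ℚ
zero-over m = 0/n≡0 (m !) {{m !≢0}}

ι-suc-nonzero : ∀ m x → ι (suc m) * x ≡ 0ℚ → x ≡ 0ℚ
ι-suc-nonzero m x [m+1]x≡0 = begin
  x                          ≡⟨ *-identityˡ x ⟨
  1ℚ * x                     ≡⟨ cong (_* x) (cancel-suc m 1) ⟨
  ι (suc m) * w * x          ≡⟨ regroup (ι (suc m)) w x ⟩
  w * (ι (suc m) * x)        ≡⟨ cong (w *_) [m+1]x≡0 ⟩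
  w * 0ℚ                     ≡⟨ *-zeroʳ w ⟩
  0ℚ                         ∎
  where
  w = + 1 / (suc m ℕ.* 1)
  regroup : ∀ a b x → a * b * x ≡ b * (a * x)
  regroup = solve-∀ ℚ-ring

over-scale : ∀ c x m → ι c * (x over m !) ≡ (c ℕ.* x) over m !
over-scale c x m = begin
  ι c * (x over m !)         ≡⟨ cong (ι c *_) (over-split x m) ⟩
  ι c * (ι x * invFact m)    ≡⟨ *-assoc (ι c) (ι x) (invFact m) ⟨
  ι c * ι x * invFact m      ≡⟨ cong (_* invFact m) (ι-* c x) ⟨
  ι (c ℕ.* x) * invFact m    ≡⟨ over-split (c ℕ.* x) m ⟨
  (c ℕ.* x) over m !         ∎

over-+ : ∀ x y m → x over m ! + y over m ! ≡ (x ℕ.+ y) over m !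
over-+ x y m = begin
  x over m ! + y over m !                 ≡⟨ cong₂ _+_ (over-split x m) (over-split y m) ⟩
  ι x * invFact m + ι y * invFact m       ≡⟨ *-distribʳ-+ (invFact m) (ι x) (ι y) ⟨
  (ι x + ι y) * invFact m                 ≡⟨ cong (_* invFact m) (ι-+ x y) ⟨
  ι (x ℕ.+ y) * invFact m                 ≡⟨ over-split (x ℕ.+ y) m ⟨
  (x ℕ.+ y) over m !                      ∎

over-suc : ∀ x m → ι (suc m) * (x over suc m !) ≡ x over m !
over-suc x m = begin
  ι (suc m) * (x over suc m !)            ≡⟨ cong (ι (suc m) *_) (over-split x (suc m)) ⟩
  ι (suc m) * (ι x * invFact (suc m))     ≡⟨ swap (ι (suc m)) (ι x) (invFact (suc m)) ⟩
  ι x * (ι (suc m) * invFact (suc m))     ≡⟨ cong (ι x *_) (invFact-suc m) ⟩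
  ι x * invFact m                         ≡⟨ over-split x m ⟨
  x over m !                              ∎
  where
  swap : ∀ a b c → a * (b * c) ≡ b * (a * c)
  swap = solve-∀ ℚ-ring

over-step : ∀ c x y m → ι c * (x over suc m !) + y over m ! ≡ (c ℕ.* x ℕ.+ suc m ℕ.* y) over suc m !
over-step c x y m = begin
  ι c * (x over suc m !) + y over m !
    ≡⟨ cong₂ _+_ (over-scale c x (suc m)) (sym (over-suc y m)) ⟩
  (c ℕ.* x) over suc m ! + ι (suc m) * (y over suc m !)
    ≡⟨ cong ((c ℕ.* x) over suc m ! +_) (over-scale (suc m) y (suc m)) ⟩
  (c ℕ.* x) over suc m ! + (suc m ℕ.* y) over suc m !
    ≡⟨ over-+ (c ℕ.* x) (suc m ℕ.* y) (suc m) ⟩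
  (c ℕ.* x ℕ.+ suc m ℕ.* y) over suc m ! ∎

sumTo-cong : ∀ m {f g : ℕ → ℚ} → (∀ i → i ≤ m → f i ≡ g i) → sumTo m f ≡ sumTo m g
sumTo-cong zero    f≗g = f≗g 0 z≤n
sumTo-cong (suc m) f≗g =
  cong₂ _+_ (sumTo-cong m (λ i i≤m → f≗g i (m≤n⇒m≤1+n i≤m))) (f≗g (suc m) ≤-refl)

sumTo-+ : ∀ m (f g : ℕ → ℚ) → sumTo m (λ i → f i + g i) ≡ sumTo m f + sumTo m g
sumTo-+ zero    f g = refl
sumTo-+ (suc m) f g = begin
  sumTo m (λ i → f i + g i) + (f (suc m) + g (suc m))  ≡⟨ cong (_+ (f (suc m) + g (suc m))) (sumTo-+ m f g) ⟩
  sumTo m f + sumTo m g + (f (suc m) + g (suc m))      ≡⟨ interchange (sumTo m f) (sumTo m g) (f (suc m)) (g (suc m)) ⟩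
  sumTo m f + f (suc m) + (sumTo m g + g (suc m))      ∎
  where
  interchange : ∀ a b c d → a + b + (c + d) ≡ a + c + (b + d)
  interchange = solve-∀ ℚ-ring

sumTo-* : ∀ m c (f : ℕ → ℚ) → sumTo m (λ i → c * f i) ≡ c * sumTo m f
sumTo-* zero    c f = refl
sumTo-* (suc m) c f = begin
  sumTo m (λ i → c * f i) + c * f (suc m)  ≡⟨ cong (_+ c * f (suc m)) (sumTo-* m c f) ⟩
  c * sumTo m f + c * f (suc m)            ≡⟨ *-distribˡ-+ c (sumTo m f) (f (suc m)) ⟨
  c * (sumTo m f + f (suc m))              ∎

sumTo-neg : ∀ m (f : ℕ → ℚ) → sumTo m (λ i → - f i) ≡ - sumTo m f
sumTo-neg zero    f = refl
sumTo-neg (suc m) f = begin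
  sumTo m (λ i → - f i) + - f (suc m)  ≡⟨ cong (_+ - f (suc m)) (sumTo-neg m f) ⟩
  - sumTo m f + - f (suc m)            ≡⟨ neg-distrib-+ (sumTo m f) (f (suc m)) ⟨
  - (sumTo m f + f (suc m))            ∎

sumTo-first : ∀ m (f : ℕ → ℚ) → sumTo (suc m) f ≡ f 0 + sumTo m (λ i → f (suc i))
sumTo-first zero    f = refl
sumTo-first (suc m) f = begin
  sumTo (suc m) f + f (suc (suc m))                         ≡⟨ cong (_+ f (suc (suc m))) (sumTo-first m f) ⟩
  f 0 + sumTo m (λ i → f (suc i)) + f (suc (suc m))         ≡⟨ +-assoc (f 0) (sumTo m (λ i → f (suc i))) (f (suc (suc m))) ⟩
  f 0 + (sumTo m (λ i → f (suc i)) + f (suc (suc m)))       ∎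

-- Cauchy products.  θ is the Euler operator x d/dx on coefficient sequences.

θ : Series → Series
θ f k = ι k * f k

θ-origin : ∀ f → θ f 0 ≡ 0ℚ
θ-origin f = *-zeroˡ (f 0)

⊛-congˡ : ∀ {f f′} g m → (∀ k → f k ≡ f′ k) → (f ⊛ g) m ≡ (f′ ⊛ g) m
⊛-congˡ g m f≗f′ = sumTo-cong m (λ i _ → cong (_* g (m ∸ i)) (f≗f′ i))

⊛-congʳ : ∀ f {g g′} m → (∀ k → g k ≡ g′ k) → (f ⊛ g) m ≡ (f ⊛ g′) m
⊛-congʳ f m g≗g′ = sumTo-cong m (λ i _ → cong (f i *_) (g≗g′ (m ∸ i)))

⊛-linearʳ : ∀ f g h c m → (f ⊛ (λ k → c * g k + h k)) m ≡ c * (f ⊛ g) m + (f ⊛ h) m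
⊛-linearʳ f g h c m = begin
  sumTo m (λ i → f i * (c * g (m ∸ i) + h (m ∸ i)))
    ≡⟨ sumTo-cong m (λ i _ → distribute (f i) c (g (m ∸ i)) (h (m ∸ i))) ⟩
  sumTo m (λ i → c * (f i * g (m ∸ i)) + f i * h (m ∸ i))
    ≡⟨ sumTo-+ m _ _ ⟩
  sumTo m (λ i → c * (f i * g (m ∸ i))) + (f ⊛ h) m
    ≡⟨ cong (_+ (f ⊛ h) m) (sumTo-* m c _) ⟩
  c * (f ⊛ g) m + (f ⊛ h) m ∎
  where
  distribute : ∀ a c x y → a * (c * x + y) ≡ c * (a * x) + a * y
  distribute = solve-∀ ℚ-ring

⊛-negˡ : ∀ f g m → ((λ k → - f k) ⊛ g) m ≡ - (f ⊛ g) m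
⊛-negˡ f g m = trans (sumTo-cong m (λ i _ → sym (neg-distribˡ-* (f i) (g (m ∸ i))))) (sumTo-neg m _)

⊛-leibniz : ∀ f g m → ι m * (f ⊛ g) m ≡ (θ f ⊛ g) m + (f ⊛ θ g) m
⊛-leibniz f g m = begin
  ι m * sumTo m (λ i → f i * g (m ∸ i))
    ≡⟨ sumTo-* m (ι m) _ ⟨
  sumTo m (λ i → ι m * (f i * g (m ∸ i)))
    ≡⟨ sumTo-cong m split ⟩
  sumTo m (λ i → θ f i * g (m ∸ i) + f i * θ g (m ∸ i))
    ≡⟨ sumTo-+ m _ _ ⟩
  (θ f ⊛ g) m + (f ⊛ θ g) m ∎
  where
  weights : ∀ p q a b → (p + q) * (a * b) ≡ p * a * b + a * (q * b)
  weights = solve-∀ ℚ-ring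
  split : ∀ i → i ≤ m → ι m * (f i * g (m ∸ i)) ≡ θ f i * g (m ∸ i) + f i * θ g (m ∸ i)
  split i i≤m = begin
    ι m * (f i * g (m ∸ i))                    ≡⟨ cong (λ k → ι k * (f i * g (m ∸ i))) (m+[n∸m]≡n i≤m) ⟨
    ι (i ℕ.+ (m ∸ i)) * (f i * g (m ∸ i))      ≡⟨ cong (_* (f i * g (m ∸ i))) (ι-+ i (m ∸ i)) ⟩
    (ι i + ι (m ∸ i)) * (f i * g (m ∸ i))      ≡⟨ weights (ι i) (ι (m ∸ i)) (f i) (g (m ∸ i)) ⟩
    θ f i * g (m ∸ i) + f i * θ g (m ∸ i)      ∎

⊛-shiftʳ : ∀ f g m → g 0 ≡ 0ℚ → (f ⊛ g) (suc m) ≡ (f ⊛ (λ k → g (suc k))) m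
⊛-shiftʳ f g m g0≡0 = begin
  S + f (suc m) * g (m ∸ m)   ≡⟨ cong (λ k → S + f (suc m) * g k) (n∸n≡0 m) ⟩
  S + f (suc m) * g 0         ≡⟨ cong (λ x → S + f (suc m) * x) g0≡0 ⟩
  S + f (suc m) * 0ℚ          ≡⟨ cong (λ x → S + x) (*-zeroʳ (f (suc m))) ⟩
  S + 0ℚ                      ≡⟨ +-identityʳ S ⟩
  S                           ≡⟨ sumTo-cong m (λ i i≤m → cong (λ k → f i * g k) (+-∸-assoc 1 i≤m)) ⟩
  (f ⊛ (λ k → g (suc k))) m   ∎
  where
  S = sumTo m (λ i → f i * g (suc m ∸ i))

⊛-shiftˡ : ∀ f g m → f 0 ≡ 0ℚ → (f ⊛ g) (suc m) ≡ ((λ k → f (suc k)) ⊛ g) m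
⊛-shiftˡ f g m f0≡0 = begin
  (f ⊛ g) (suc m)                                  ≡⟨ sumTo-first m _ ⟩
  f 0 * g (suc m) + ((λ k → f (suc k)) ⊛ g) m      ≡⟨ cong (λ x → x * g (suc m) + ((λ k → f (suc k)) ⊛ g) m) f0≡0 ⟩
  0ℚ * g (suc m) + ((λ k → f (suc k)) ⊛ g) m       ≡⟨ cong (_+ ((λ k → f (suc k)) ⊛ g) m) (*-zeroˡ (g (suc m))) ⟩
  0ℚ + ((λ k → f (suc k)) ⊛ g) m                   ≡⟨ +-identityˡ _ ⟩
  ((λ k → f (suc k)) ⊛ g) m                        ∎

θ-expNeg : ∀ k → θ expNeg (suc k) ≡ - expNeg k
θ-expNeg zero    = refl
θ-expNeg (suc k) = flip-sign {ι (suc (suc k))} {invFact (suc (suc k))} (invFact-suc (suc k))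
  where
  flip-sign : ∀ {q i i′ s} → q * i ≡ i′ → q * (- i * - s) ≡ - (- i′ * s)
  flip-sign {q} {i} {i′} {s} qi≡i′ = begin
    q * (- i * - s)  ≡⟨ regroup q i s ⟩
    q * i * s        ≡⟨ cong (_* s) qi≡i′ ⟩
    i′ * s           ≡⟨ double-neg i′ s ⟩
    - (- i′ * s)     ∎
    where
    regroup : ∀ q i s → q * (- i * - s) ≡ q * i * s
    regroup = solve-∀ ℚ-ring
    double-neg : ∀ i s → i * s ≡ - (- i * s)
    double-neg = solve-∀ ℚ-ring

θ-invFact : ∀ k → θ invFact (suc k) ≡ invFact k
θ-invFact = invFact-suc

-- [x^{m+1}] e^{-x} e^x = 0, via the Leibniz rule.
expNeg-expPos : ∀ m → (expNeg ⊛ invFact) (suc m) ≡ 0ℚ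
expNeg-expPos m = ι-suc-nonzero m _ (begin
  ι (suc m) * (expNeg ⊛ invFact) (suc m)
    ≡⟨ ⊛-leibniz expNeg invFact (suc m) ⟩
  (θ expNeg ⊛ invFact) (suc m) + (expNeg ⊛ θ invFact) (suc m)
    ≡⟨ cong₂ _+_ (⊛-shiftˡ (θ expNeg) invFact m (θ-origin expNeg))
                 (⊛-shiftʳ expNeg (θ invFact) m (θ-origin invFact)) ⟩
  ((λ k → θ expNeg (suc k)) ⊛ invFact) m + (expNeg ⊛ (λ k → θ invFact (suc k))) m
    ≡⟨ cong₂ _+_ (⊛-congˡ invFact m θ-expNeg) (⊛-congʳ expNeg m θ-invFact) ⟩
  ((λ k → - expNeg k) ⊛ invFact) m + (expNeg ⊛ invFact) m
    ≡⟨ cong (_+ (expNeg ⊛ invFact) m) (⊛-negˡ expNeg invFact m) ⟩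
  - (expNeg ⊛ invFact) m + (expNeg ⊛ invFact) m
    ≡⟨ +-inverseˡ ((expNeg ⊛ invFact) m) ⟩
  0ℚ ∎)

-- The series R_{a,n} = Σ_k ⟨k+a⟩_n x^k / k!; risingSeries n r is R_{2r,n}.

risingFrom : ℕ → ℕ → Series
risingFrom a n k = rising (k ℕ.+ a) n over k !

-- R_{a,n+1} = (a+n) R_{a,n} + θ R_{a,n}, from ⟨k+a⟩_{n+1} = ⟨k+a⟩_n (k+a+n).
risingFrom-suc : ∀ a n k → risingFrom a (suc n) k ≡ ι (a ℕ.+ n) * risingFrom a n k + θ (risingFrom a n) k
risingFrom-suc a n k = begin
  (R ℕ.* (k ℕ.+ a ℕ.+ n)) over k !                      ≡⟨ cong (_over k !) (expand R k a n) ⟩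
  ((a ℕ.+ n) ℕ.* R ℕ.+ k ℕ.* R) over k !                ≡⟨ over-+ ((a ℕ.+ n) ℕ.* R) (k ℕ.* R) k ⟨
  ((a ℕ.+ n) ℕ.* R) over k ! + (k ℕ.* R) over k !       ≡⟨ cong₂ _+_ (over-scale (a ℕ.+ n) R k) (over-scale k R k) ⟨
  ι (a ℕ.+ n) * (R over k !) + ι k * (R over k !)       ∎
  where
  R = rising (k ℕ.+ a) n
  expand : ∀ R k a n → R ℕ.* (k ℕ.+ a ℕ.+ n) ≡ (a ℕ.+ n) ℕ.* R ℕ.+ k ℕ.* R
  expand = ℕ-solve-∀

θ-risingFrom : ∀ a n k → θ (risingFrom a n) (suc k) ≡ risingFrom (suc a) n k
θ-risingFrom a n k = begin
  ι (suc k) * (rising (suc k ℕ.+ a) n over suc k !)  ≡⟨ over-suc (rising (suc k ℕ.+ a) n) k ⟩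
  rising (suc k ℕ.+ a) n over k !                    ≡⟨ cong (λ j → rising j n over k !) (sym (+-suc k a)) ⟩
  rising (k ℕ.+ suc a) n over k !                    ∎

⊛-risingFrom-suc : ∀ f a n m →
  (f ⊛ risingFrom a (suc n)) m ≡ ι (a ℕ.+ n) * (f ⊛ risingFrom a n) m + (f ⊛ θ (risingFrom a n)) m
⊛-risingFrom-suc f a n m =
  trans (⊛-congʳ f m (risingFrom-suc a n)) (⊛-linearʳ f (risingFrom a n) (θ (risingFrom a n)) (ι (a ℕ.+ n)) m)

coeff-expNeg-rising : ∀ a n m → (expNeg ⊛ risingFrom a n) m ≡ lah a n m over m !
coeff-expNeg-rising a zero    zero    = refl
coeff-expNeg-rising a zero    (suc m) = trans (expNeg-expPos m) (sym (zero-over (suc m)))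
coeff-expNeg-rising a (suc n) zero    = begin
  (expNeg ⊛ risingFrom a (suc n)) 0                                     ≡⟨ ⊛-risingFrom-suc expNeg a n 0 ⟩
  ι (a ℕ.+ n) * (expNeg ⊛ R) 0 + expNeg 0 * (ι 0 * R 0)                 ≡⟨ cong₂ _+_ (cong (ι (a ℕ.+ n) *_) (coeff-expNeg-rising a n 0)) no-constant-term ⟩
  ι (a ℕ.+ n) * (lah a n 0 over 0 !) + 0ℚ                               ≡⟨ +-identityʳ _ ⟩
  ι (a ℕ.+ n) * (lah a n 0 over 0 !)                                    ≡⟨ over-scale (a ℕ.+ n) (lah a n 0) 0 ⟩
  lah a (suc n) 0 over 0 !                                              ∎
  where
  R = risingFrom a n
  no-constant-term : expNeg 0 * (ι 0 * R 0) ≡ 0ℚ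
  no-constant-term = trans (cong (expNeg 0 *_) (θ-origin R)) (*-zeroʳ (expNeg 0))
coeff-expNeg-rising a (suc n) (suc m) = begin
  (expNeg ⊛ risingFrom a (suc n)) (suc m)
    ≡⟨ ⊛-risingFrom-suc expNeg a n (suc m) ⟩
  ι (a ℕ.+ n) * (expNeg ⊛ R) (suc m) + (expNeg ⊛ θ R) (suc m)
    ≡⟨ cong (λ x → ι (a ℕ.+ n) * (expNeg ⊛ R) (suc m) + x) (⊛-shiftʳ expNeg (θ R) m (θ-origin R)) ⟩
  ι (a ℕ.+ n) * (expNeg ⊛ R) (suc m) + (expNeg ⊛ (λ k → θ R (suc k))) m
    ≡⟨ cong (λ x → ι (a ℕ.+ n) * (expNeg ⊛ R) (suc m) + x) (⊛-congʳ expNeg m (θ-risingFrom a n)) ⟩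
  ι (a ℕ.+ n) * (expNeg ⊛ R) (suc m) + (expNeg ⊛ risingFrom (suc a) n) m
    ≡⟨ cong₂ (λ x y → ι (a ℕ.+ n) * x + y) (coeff-expNeg-rising a n (suc m)) (coeff-expNeg-rising (suc a) n m) ⟩
  ι (a ℕ.+ n) * (lah a n (suc m) over suc m !) + lah (suc a) n m over m !
    ≡⟨ over-step (a ℕ.+ n) (lah a n (suc m)) (lah (suc a) n m) m ⟩
  lah a (suc n) (suc m) over suc m ! ∎
  where
  R = risingFrom a n

lahR-lah : ∀ r n k → k ≤ n → lahR r n k ≡ lah (2 ℕ.* r) n k over k !
lahR-lah zero    zero    zero    _   = refl
lahR-lah zero    (suc n) zero    _   = cong (_over 0 !) (sym (lah-zero-column n))
lahR-lah zero    n       (suc m) k≤n = cong (_over suc m !) (sym (lah-binomial 0 n (suc m) _ k≤n refl))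
lahR-lah (suc r) n       zero    k≤n = cong (_over 0 !) (sym (lah-binomial (2 ℕ.* suc r) n 0 _ k≤n refl))
lahR-lah (suc r) n       (suc m) k≤n = cong (_over suc m !) (sym (lah-binomial (2 ℕ.* suc r) n (suc m) _ k≤n refl))

theorem5 : (n r : ℕ) → (k : ℕ) →
    lahBell n r k ≡ (expNeg ⊛ risingSeries n r) k
theorem5 n r k with k ≤? n
... | yes k≤n = begin
  lahR r n k                             ≡⟨ lahR-lah r n k k≤n ⟩
  lah (2 ℕ.* r) n k over k !             ≡⟨ coeff-expNeg-rising (2 ℕ.* r) n k ⟨
  (expNeg ⊛ risingSeries n r) k          ∎
... | no k≰n = begin
  0ℚ                                     ≡⟨ zero-over k ⟨
  0 over k !                             ≡⟨ cong (_over k !) (lah-vanish (2 ℕ.* r) n k (≰⇒> k≰n)) ⟨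
  lah (2 ℕ.* r) n k over k !             ≡⟨ coeff-expNeg-rising (2 ℕ.* r) n k ⟨
  (expNeg ⊛ risingSeries n r) k          ∎
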